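{- Let $A,A'\subseteq\mathcal U$ be small sets and $a,a'$ tuples of the same length. If $(A,a)\equiv(A',a')$, then $\operatorname{tp}(a/A)$ is compressible if and only if $\operatorname{tp}(a'/A')$ is compressible.
   Context: $T$ is a complete first-order theory in language $L$, $\mathcal U$ a monster model. For a set $A$ and tuple $a$, $(A,a)$ is the structure with universe $A$ having, for each $L$-formula $\phi(\bar x;y)$, a predicate $R_\phi$ interpreted as $\{\bar b\in A:\models\phi(\bar b;a)\}$; $\equiv$ is elementary equivalence in this language. $\operatorname{tp}_\phi(a/A)$ is the set of instances $\phi(x;b)$, $\neg\phi(x;b)$, $b\in A$, satisfied by $a$. $\operatorname{tp}(a/A)$ is compressible if, for an $|A|^+$-saturated elementary extension $(A,a)\prec(A'',a)$ (with $A''\subseteq\mathcal U$), for every $L$-formula $\phi(x;y)$ there is $\zeta(x;e)\in\operatorname{tp}(a/A'')$ with $\zeta(x;e)\vdash\operatorname{tp}_\phi(a/A)$; equivalently, for every $\phi(x;y)$ there is an $L$-formula $\zeta(x;t)$ such that for every finite $A_0\subseteq A$ there is $e\in A$ with $\models\zeta(a;e)$ and $\zeta(x;e)\vdash\operatorname{tp}_\phi(a/A_0)$. -}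

module Defs where

open import Data.Nat using (ℕ; zero; suc; _+_)
open import Data.Fin using (Fin)
open import Data.Vec using (Vec; []; _∷_; lookup; _++_; map)
open import Data.Vec.Relation.Unary.All as VAll using ()
open import Data.List using (List)
open import Data.List.Relation.Unary.All as LAll using ()
open import Data.List.Membership.Propositional using (_∈_)
open import Data.Product using (Σ; _×_; proj₁)
open import Data.Sum using (_⊎_)
open import Data.Empty using (⊥)
open import Data.Unit using (⊤)
open import Relation.Nullary using (¬_)
open import Relation.Binary.PropositionalEquality using (_≡_)

record Language : Set₁ where
  field
    Func : ℕ → Set
    Rel  : ℕ → Set
open Language public

data Term (L : Language) (n : ℕ) : Set where
  var : Fin n → Term L n
  app : ∀ {m} → Func L m → Vec (Term L n) m → Term L n

data Formula (L : Language) : ℕ → Set where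
  falsum : ∀ {n} → Formula L n
  verum  : ∀ {n} → Formula L n
  rel    : ∀ {n m} → Rel L m → Vec (Term L n) m → Formula L n
  _≐_    : ∀ {n} → Term L n → Term L n → Formula L n
  neg    : ∀ {n} → Formula L n → Formula L n
  _∧'_   : ∀ {n} → Formula L n → Formula L n → Formula L n
  _∨'_   : ∀ {n} → Formula L n → Formula L n → Formula L n
  _⇒'_   : ∀ {n} → Formula L n → Formula L n → Formula L n
  all'   : ∀ {n} → Formula L (suc n) → Formula L n
  ex'    : ∀ {n} → Formula L (suc n) → Formula L n

record Structure (L : Language) : Set₁ where
  field
    Carrier : Set
    funI    : ∀ {m} → Func L m → Vec Carrier m → Carrier
    relI    : ∀ {m} → Rel L m → Vec Carrier m → Set
open Structure public

module _ {L : Language} (M : Structure L) where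
  mutual
    evalTerm : ∀ {n} → Term L n → Vec (Carrier M) n → Carrier M
    evalTerm (var i)    ρ = lookup ρ i
    evalTerm (app f ts) ρ = funI M f (evalTerms ts ρ)

    evalTerms : ∀ {n m} → Vec (Term L n) m → Vec (Carrier M) n → Vec (Carrier M) m
    evalTerms []       ρ = []
    evalTerms (t ∷ ts) ρ = evalTerm t ρ ∷ evalTerms ts ρ

  -- M ⊨ φ[ρ]   (variable 0 is the most recently bound one / head of ρ)
  Sat : ∀ {n} → Formula L n → Vec (Carrier M) n → Set
  Sat falsum     ρ = ⊥
  Sat verum      ρ = ⊤
  Sat (rel R ts) ρ = relI M R (evalTerms ts ρ)
  Sat (s ≐ t)    ρ = evalTerm s ρ ≡ evalTerm t ρ
  Sat (neg φ)    ρ = ¬ Sat φ ρ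
  Sat (φ ∧' ψ)   ρ = Sat φ ρ × Sat ψ ρ
  Sat (φ ∨' ψ)   ρ = Sat φ ρ ⊎ Sat ψ ρ
  Sat (φ ⇒' ψ)   ρ = Sat φ ρ → Sat ψ ρ
  Sat (all' φ)   ρ = (c : Carrier M) → Sat φ (c ∷ ρ)
  Sat (ex' φ)    ρ = Σ (Carrier M) λ c → Sat φ (c ∷ ρ)

ElemEquiv : {L : Language} → Structure L → Structure L → Set
ElemEquiv {L} M N =
  (σ : Formula L 0) → (Sat M σ [] → Sat N σ []) × (Sat N σ [] → Sat M σ [])

-- For a tuple a of length k, the language has, for each L-formula
-- φ(x̄ ; y) with x̄ of length n and y of length k (free variables
-- Fin (n + k), the first n being x̄), an n-ary predicate R_φ.

IndLang : Language → ℕ → Language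
IndLang L k = record { Func = λ _ → ⊥ ; Rel = λ n → Formula L (n + k) }

Ind : {L : Language} (U : Structure L) (A : Carrier U → Set) {k : ℕ}
    → Vec (Carrier U) k → Structure (IndLang L k)
Ind {L} U A {k} a = record
  { Carrier = Σ (Carrier U) A
  ; funI    = λ ()
  ; relI    = λ φ bs → Sat U φ (map proj₁ bs ++ a)
  }

-- Compressibility (finitary characterization from the paper):
-- for every φ(x;y) there is ζ(x;t) such that for every finite A₀ ⊆ A
-- there is e ∈ A with ⊨ ζ(a;e) and ζ(x;e) ⊢ tp_φ(a/A₀).
-- Here x has length k (= |a|), y length m, t length l.

-- ζ(x;e) ⊢ tp_φ(a/A₀): every x in U satisfying ζ(x;e) satisfies every
-- instance φ(x;b), ¬φ(x;b) (b a tuple from A₀) satisfied by a.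
Entails : {L : Language} (U : Structure L) {k m l : ℕ}
        → (a : Vec (Carrier U) k)
        → (φ : Formula L (k + m)) (ζ : Formula L (k + l))
        → (e : Vec (Carrier U) l) (A₀ : List (Carrier U)) → Set
Entails U {k} {m} a φ ζ e A₀ =
  (x : Vec (Carrier U) k) → Sat U ζ (x ++ e) →
  (b : Vec (Carrier U) m) → VAll.All (_∈ A₀) b →
    (Sat U φ (a ++ b) → Sat U φ (x ++ b)) ×
    (Sat U (neg φ) (a ++ b) → Sat U (neg φ) (x ++ b))

Compressible : {L : Language} (U : Structure L) (A : Carrier U → Set) {k : ℕ}
             → Vec (Carrier U) k → Set
Compressible {L} U A {k} a =
  (m : ℕ) (φ : Formula L (k + m)) →
  Σ ℕ λ l → Σ (Formula L (k + l)) λ ζ →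
    (A₀ : List (Carrier U)) → LAll.All A A₀ →
    Σ (Vec (Carrier U) l) λ e →
      VAll.All A e × Sat U ζ (a ++ e) × Entails U a φ ζ e A₀

{-# OPTIONS --safe #-}
-- For fixed φ(x; y) and ζ(x; t), the condition "for every n-element A₀ ⊆ A there is e ∈ A with
-- ⊨ ζ(a; e) and ζ(x; e) ⊢ tp_φ(a/A₀)" is a single sentence of (A, a): the requirement on e and
-- an enumeration c of A₀ is an L-formula θ(e, c; a) with the tuple a as parameter, i.e. the atomic
-- formula R_θ(e, c) of (A, a), and the quantifiers over e and c range over A.  Hence
-- tp(a/A) is compressible iff for every φ there is ζ such that (A, a) satisfies all these
-- sentences, a property of the theory of (A, a).

module Submission where

open import Defs
open import Data.Nat using (ℕ; zero; suc; _+_)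
open import Data.Fin using (Fin; zero; suc; _↑ˡ_; _↑ʳ_; splitAt; lift)
open import Data.Fin.Properties using (∀-cons-⇔; ⊎⇔∃)
open import Data.List using (List)
import Data.List.Relation.Unary.All as LAll
open import Data.List.Membership.Propositional using (_∈_)
open import Data.Vec using (Vec; []; _∷_; lookup; _++_; map; tabulate; toList; fromList)
open import Data.Vec.Properties
  using (lookup-splitAt; lookup-++ˡ; lookup-++ʳ; map-++; tabulate-∘; tabulate∘lookup; toList∘fromList)
import Data.Vec.Relation.Unary.All as VAll
import Data.Vec.Relation.Unary.All.Properties as VAllₚ
open import Data.Vec.Relation.Unary.Any using (index)
open import Data.Vec.Relation.Unary.Any.Properties using (lookup-index)
open import Data.Vec.Membership.Propositional using () renaming (_∈_ to _∈ᵥ_)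
open import Data.Vec.Membership.Propositional.Properties using (∈-lookup; ∈-toList⁺; ∈-toList⁻)
open import Data.Product using (Σ; ∃; _×_; _,_; proj₁; proj₂; uncurry)
open import Data.Product.Function.NonDependent.Propositional using (_×-⇔_)
open import Data.Sum using (inj₁; inj₂; [_,_]′)
open import Data.Sum.Function.Propositional using (_⊎-⇔_)
open import Function using (_∘_)
open import Function.Bundles using (_⇔_; mk⇔; Equivalence)
open import Function.Construct.Identity using (⇔-id)
open import Function.Construct.Symmetry using (⇔-sym)
open import Function.Construct.Composition using (_⇔-∘_)
open import Function.Properties.Equivalence using (⇔-setoid)
open import Function.Related.Propositional using (≡⇒; equivalence)
open import Function.Related.TypeIsomorphisms using (→-cong-⇔; ¬-cong-⇔)
open import Level using (0ℓ)
open import Relation.Binary.PropositionalEquality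
  using (_≡_; refl; sym; trans; cong; cong₂; subst; module ≡-Reasoning)
import Relation.Binary.Reasoning.Setoid as SetoidReasoning

open Equivalence using (to; from)

≡⇒⇔ : {A B : Set} → A ≡ B → A ⇔ B
≡⇒⇔ = ≡⇒ {k = equivalence}

Π-cong-⇔ : {X : Set} {P Q : X → Set} → (∀ x → P x ⇔ Q x) → ((x : X) → P x) ⇔ ((x : X) → Q x)
Π-cong-⇔ P⇔Q = mk⇔ (λ f x → to (P⇔Q x) (f x)) (λ g x → from (P⇔Q x) (g x))

Σ-cong-⇔ : {X : Set} {P Q : X → Set} → (∀ x → P x ⇔ Q x) → Σ X P ⇔ Σ X Q
Σ-cong-⇔ P⇔Q = mk⇔ (λ (x , p) → x , to (P⇔Q x) p) (λ (x , q) → x , from (P⇔Q x) q)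

module _ {C : Set} {n : ℕ} {P : Vec C (suc n) → Set} where

  ∀-∷⇔ : ((xs : Vec C n) (x : C) → P (x ∷ xs)) ⇔ ((xs : Vec C (suc n)) → P xs)
  ∀-∷⇔ = mk⇔ (λ f → λ { (x ∷ xs) → f xs x }) (λ f xs x → f (x ∷ xs))

  ∃-∷⇔ : (∃ λ (xs : Vec C n) → ∃ λ (x : C) → P (x ∷ xs)) ⇔ ∃ P
  ∃-∷⇔ = mk⇔ (λ (xs , x , p) → x ∷ xs , p) (λ { (x ∷ xs , p) → xs , x , p })

record Agree {C : Set} {n n' : ℕ} (r : Fin n → Fin n') (ρ : Vec C n) (ρ' : Vec C n') : Set where
  constructor agree
  field lookup-agree : ∀ i → lookup ρ' (r i) ≡ lookup ρ i

_⊕_ : ∀ {m n N} → (Fin m → Fin N) → (Fin n → Fin N) → Fin (m + n) → Fin N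
_⊕_ {m} r s i = [ r , s ]′ (splitAt m i)

module _ {C : Set} where

  ↑ˡ-agree : ∀ {m n} (ρ : Vec C m) (σ : Vec C n) → Agree (_↑ˡ n) ρ (ρ ++ σ)
  ↑ˡ-agree ρ σ = agree (lookup-++ˡ ρ σ)

  ↑ʳ-agree : ∀ {m n} (ρ : Vec C m) (σ : Vec C n) → Agree (m ↑ʳ_) σ (ρ ++ σ)
  ↑ʳ-agree ρ σ = agree (lookup-++ʳ ρ σ)

  ∘-agree : ∀ {n₁ n₂ n₃} {r : Fin n₁ → Fin n₂} {s : Fin n₂ → Fin n₃}
              {ρ₁ : Vec C n₁} {ρ₂ : Vec C n₂} {ρ₃ : Vec C n₃} →
            Agree r ρ₁ ρ₂ → Agree s ρ₂ ρ₃ → Agree (s ∘ r) ρ₁ ρ₃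
  ∘-agree (agree r≈) (agree s≈) = agree (λ i → trans (s≈ _) (r≈ i))

  ⊕-agree : ∀ {m n N} {r : Fin m → Fin N} {s : Fin n → Fin N}
              {ρ : Vec C m} {σ : Vec C n} {τ : Vec C N} →
            Agree r ρ τ → Agree s σ τ → Agree (r ⊕ s) (ρ ++ σ) τ
  ⊕-agree {m} {r = r} {s} {ρ} {σ} {τ} (agree r≈) (agree s≈) = agree agree-split
    where
      agree-split : ∀ i → lookup τ ((r ⊕ s) i) ≡ lookup (ρ ++ σ) i
      agree-split i rewrite lookup-splitAt m ρ σ i with splitAt m i
      ... | inj₁ j = r≈ j
      ... | inj₂ j = s≈ j

  lift-agree : ∀ {n n'} {r : Fin n → Fin n'} {ρ : Vec C n} {ρ' : Vec C n'} {x : C} →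
               Agree r ρ ρ' → Agree (lift 1 r) (x ∷ ρ) (x ∷ ρ')
  lift-agree (agree r≈) = agree λ { zero → refl ; (suc i) → r≈ i }

module _ {L : Language} where

  mutual
    renameTerm : ∀ {n n'} → (Fin n → Fin n') → Term L n → Term L n'
    renameTerm r (var i)    = var (r i)
    renameTerm r (app f ts) = app f (renameTerms r ts)

    renameTerms : ∀ {n n' m} → (Fin n → Fin n') → Vec (Term L n) m → Vec (Term L n') m
    renameTerms r []       = []
    renameTerms r (t ∷ ts) = renameTerm r t ∷ renameTerms r ts

  rename : ∀ {n n'} → (Fin n → Fin n') → Formula L n → Formula L n'
  rename r falsum     = falsum
  rename r verum      = verum
  rename r (rel R ts) = rel R (renameTerms r ts)
  rename r (s ≐ t)    = renameTerm r s ≐ renameTerm r t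
  rename r (neg φ)    = neg (rename r φ)
  rename r (φ ∧' ψ)   = rename r φ ∧' rename r ψ
  rename r (φ ∨' ψ)   = rename r φ ∨' rename r ψ
  rename r (φ ⇒' ψ)   = rename r φ ⇒' rename r ψ
  rename r (all' φ)   = all' (rename (lift 1 r) φ)
  rename r (ex' φ)    = ex' (rename (lift 1 r) φ)

  module _ (M : Structure L) {n n' : ℕ} {r : Fin n → Fin n'}
           {ρ : Vec (Carrier M) n} {ρ' : Vec (Carrier M) n'} (r≈ : Agree r ρ ρ') where

    mutual
      rename-evalTerm : (t : Term L n) → evalTerm M (renameTerm r t) ρ' ≡ evalTerm M t ρ
      rename-evalTerm (var i)    = Agree.lookup-agree r≈ i
      rename-evalTerm (app f ts) = cong (funI M f) (rename-evalTerms ts)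

      rename-evalTerms : ∀ {m} (ts : Vec (Term L n) m) → evalTerms M (renameTerms r ts) ρ' ≡ evalTerms M ts ρ
      rename-evalTerms []       = refl
      rename-evalTerms (t ∷ ts) = cong₂ _∷_ (rename-evalTerm t) (rename-evalTerms ts)

  rename-sat : (M : Structure L) {n n' : ℕ} {r : Fin n → Fin n'}
               {ρ : Vec (Carrier M) n} {ρ' : Vec (Carrier M) n'} →
               Agree r ρ ρ' → (φ : Formula L n) → Sat M (rename r φ) ρ' ⇔ Sat M φ ρ
  rename-sat M r≈ falsum     = ⇔-id _
  rename-sat M r≈ verum      = ⇔-id _
  rename-sat M r≈ (rel R ts) = ≡⇒⇔ (cong (relI M R) (rename-evalTerms M r≈ ts))
  rename-sat M r≈ (s ≐ t)    = ≡⇒⇔ (cong₂ _≡_ (rename-evalTerm M r≈ s) (rename-evalTerm M r≈ t))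
  rename-sat M r≈ (neg φ)    = ¬-cong-⇔ (rename-sat M r≈ φ)
  rename-sat M r≈ (φ ∧' ψ)   = rename-sat M r≈ φ ×-⇔ rename-sat M r≈ ψ
  rename-sat M r≈ (φ ∨' ψ)   = rename-sat M r≈ φ ⊎-⇔ rename-sat M r≈ ψ
  rename-sat M r≈ (φ ⇒' ψ)   = →-cong-⇔ (rename-sat M r≈ φ) (rename-sat M r≈ ψ)
  rename-sat M r≈ (all' φ)   = Π-cong-⇔ λ _ → rename-sat M (lift-agree r≈) φ
  rename-sat M r≈ (ex' φ)    = Σ-cong-⇔ λ _ → rename-sat M (lift-agree r≈) φ

module _ {L : Language} where

  allⁿ : ∀ n {j} → Formula L (n + j) → Formula L j
  allⁿ zero    ψ = ψ
  allⁿ (suc n) ψ = allⁿ n (all' ψ)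

  exⁿ : ∀ n {j} → Formula L (n + j) → Formula L j
  exⁿ zero    ψ = ψ
  exⁿ (suc n) ψ = exⁿ n (ex' ψ)

  ∀-closure : ∀ n → Formula L n → Formula L 0
  ∀-closure zero    ψ = ψ
  ∀-closure (suc n) ψ = ∀-closure n (all' ψ)

  ⋀ : ∀ {N} m → (Fin m → Formula L N) → Formula L N
  ⋀ zero    ψ = verum
  ⋀ (suc m) ψ = ψ zero ∧' ⋀ m (ψ ∘ suc)

  ⋁ : ∀ {N} m → (Fin m → Formula L N) → Formula L N
  ⋁ zero    ψ = falsum
  ⋁ (suc m) ψ = ψ zero ∨' ⋁ m (ψ ∘ suc)

  _⊆ᶠ_ : ∀ {m n N} → (Fin m → Fin N) → (Fin n → Fin N) → Formula L N
  _⊆ᶠ_ {m} {n} s r = ⋀ m λ j → ⋁ n λ i → var (s j) ≐ var (r i)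

  module _ (M : Structure L) where

    allⁿ-sat : ∀ n {j} (ψ : Formula L (n + j)) (ρ : Vec (Carrier M) j) →
               Sat M (allⁿ n ψ) ρ ⇔ (∀ xs → Sat M ψ (xs ++ ρ))
    allⁿ-sat zero    ψ ρ = mk⇔ (λ p → λ { [] → p }) (λ f → f [])
    allⁿ-sat (suc n) ψ ρ = ∀-∷⇔ ⇔-∘ allⁿ-sat n (all' ψ) ρ

    exⁿ-sat : ∀ n {j} (ψ : Formula L (n + j)) (ρ : Vec (Carrier M) j) →
              Sat M (exⁿ n ψ) ρ ⇔ (∃ λ xs → Sat M ψ (xs ++ ρ))
    exⁿ-sat zero    ψ ρ = mk⇔ ([] ,_) (λ { ([] , p) → p })
    exⁿ-sat (suc n) ψ ρ = ∃-∷⇔ ⇔-∘ exⁿ-sat n (ex' ψ) ρ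

    ∀-closure-sat : ∀ n (ψ : Formula L n) → Sat M (∀-closure n ψ) [] ⇔ (∀ xs → Sat M ψ xs)
    ∀-closure-sat zero    ψ = mk⇔ (λ p → λ { [] → p }) (λ f → f [])
    ∀-closure-sat (suc n) ψ = ∀-∷⇔ ⇔-∘ ∀-closure-sat n (all' ψ)

    ⋀-sat : ∀ {N} m (ψ : Fin m → Formula L N) ρ → Sat M (⋀ m ψ) ρ ⇔ (∀ j → Sat M (ψ j) ρ)
    ⋀-sat zero    ψ ρ = mk⇔ (λ _ ()) _
    ⋀-sat (suc m) ψ ρ = ∀-cons-⇔ ⇔-∘ (⇔-id _ ×-⇔ ⋀-sat m (ψ ∘ suc) ρ)

    ⋁-sat : ∀ {N} m (ψ : Fin m → Formula L N) ρ → Sat M (⋁ m ψ) ρ ⇔ (∃ λ i → Sat M (ψ i) ρ)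
    ⋁-sat zero    ψ ρ = mk⇔ (λ ()) (λ ())
    ⋁-sat (suc m) ψ ρ = ⊎⇔∃ ⇔-∘ (⇔-id _ ⊎-⇔ ⋁-sat m (ψ ∘ suc) ρ)

∃-lookup⇔∈-toList : ∀ {C : Set} {n} {x : C} (c : Vec C n) → (∃ λ i → x ≡ lookup c i) ⇔ x ∈ toList c
∃-lookup⇔∈-toList c = mk⇔
  (λ (i , x≡cᵢ) → ∈-toList⁺ (subst (_∈ᵥ c) (sym x≡cᵢ) (∈-lookup i c)))
  (λ x∈c → let x∈ᵥc = ∈-toList⁻ x∈c in index x∈ᵥc , lookup-index x∈ᵥc)

All⇔lookup : ∀ {C : Set} {P : C → Set} {n} {xs : Vec C n} → VAll.All P xs ⇔ (∀ i → P (lookup xs i))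
All⇔lookup = mk⇔ VAllₚ.lookup⁺ VAllₚ.lookup⁻

⊆ᶠ-sat : ∀ {L} (M : Structure L) {m n N} {s : Fin m → Fin N} {r : Fin n → Fin N}
           {b : Vec (Carrier M) m} {c : Vec (Carrier M) n} {ρ : Vec (Carrier M) N} →
         Agree s b ρ → Agree r c ρ → Sat M (s ⊆ᶠ r) ρ ⇔ VAll.All (_∈ toList c) b
⊆ᶠ-sat M {m} {n} {s = s} {r} {b} {c} {ρ} (agree s≈) (agree r≈) =
  ⇔-sym All⇔lookup ⇔-∘ (Π-cong-⇔ b-member ⇔-∘ ⋀-sat M m _ ρ)
  where
    b-member : ∀ j → Sat M (⋁ n λ i → var (s j) ≐ var (r i)) ρ ⇔ lookup b j ∈ toList c
    b-member j =
      ∃-lookup⇔∈-toList c ⇔-∘ (Σ-cong-⇔ (λ i → ≡⇒⇔ (cong₂ _≡_ (s≈ j) (r≈ i))) ⇔-∘ ⋁-sat M n _ ρ)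

-- The variables of θ(e, c; y) are laid out as (e ++ c) ++ y: this is how (A, a) evaluates
-- the predicate R_θ on the tuple (e, c), with y := a.
module Compression {L : Language} {k m l : ℕ} (φ : Formula L (k + m)) (ζ : Formula L (k + l)) (n : ℕ) where

  ctx : ℕ
  ctx = (l + n) + k

  eᵥ : Fin l → Fin ctx
  eᵥ = (_↑ˡ k) ∘ (_↑ˡ n)

  cᵥ : Fin n → Fin ctx
  cᵥ = (_↑ˡ k) ∘ (l ↑ʳ_)

  yᵥ : Fin k → Fin ctx
  yᵥ = (l + n) ↑ʳ_

  xᵥ : Fin k → Fin (k + ctx)
  xᵥ = _↑ˡ ctx

  bᵥ : Fin m → Fin (m + (k + ctx))
  bᵥ = _↑ˡ (k + ctx)

  wk-x : Fin ctx → Fin (k + ctx)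
  wk-x = k ↑ʳ_

  wk-b : Fin (k + ctx) → Fin (m + (k + ctx))
  wk-b = m ↑ʳ_

  φ-yb φ-xb : Formula L (m + (k + ctx))
  φ-yb = rename ((wk-b ∘ wk-x ∘ yᵥ) ⊕ bᵥ) φ
  φ-xb = rename ((wk-b ∘ xᵥ) ⊕ bᵥ) φ

  φ-transfers : Formula L (m + (k + ctx))
  φ-transfers = (φ-yb ⇒' φ-xb) ∧' (neg φ-yb ⇒' neg φ-xb)

  entails : Formula L ctx
  entails = allⁿ k (rename (xᵥ ⊕ (wk-x ∘ eᵥ)) ζ ⇒' allⁿ m ((bᵥ ⊆ᶠ (wk-b ∘ wk-x ∘ cᵥ)) ⇒' φ-transfers))

  θ : Formula L ctx
  θ = rename (yᵥ ⊕ eᵥ) ζ ∧' entails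

  module _ (M : Structure L) (e : Vec (Carrier M) l) (c : Vec (Carrier M) n) (y : Vec (Carrier M) k) where

    private
      E : Vec (Carrier M) ctx
      E = (e ++ c) ++ y

      e≈ : Agree eᵥ e E
      e≈ = ∘-agree (↑ˡ-agree e c) (↑ˡ-agree (e ++ c) y)

      c≈ : Agree cᵥ c E
      c≈ = ∘-agree (↑ʳ-agree e c) (↑ˡ-agree (e ++ c) y)

      y≈ : Agree yᵥ y E
      y≈ = ↑ʳ-agree (e ++ c) y

      module _ (x : Vec (Carrier M) k) (b : Vec (Carrier M) m) where

        b≈ : Agree bᵥ b (b ++ (x ++ E))
        b≈ = ↑ˡ-agree b (x ++ E)

        wk-xb≈ : Agree (wk-b ∘ wk-x) E (b ++ (x ++ E))
        wk-xb≈ = ∘-agree (↑ʳ-agree x E) (↑ʳ-agree b (x ++ E))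

        φ-transfers-sat : Sat M φ-transfers (b ++ (x ++ E)) ⇔
                          ((Sat M φ (y ++ b) → Sat M φ (x ++ b)) ×
                           (Sat M (neg φ) (y ++ b) → Sat M (neg φ) (x ++ b)))
        φ-transfers-sat = →-cong-⇔ φy φx ×-⇔ →-cong-⇔ (¬-cong-⇔ φy) (¬-cong-⇔ φx)
          where
            φy = rename-sat M (⊕-agree (∘-agree y≈ wk-xb≈) b≈) φ
            φx = rename-sat M (⊕-agree (∘-agree (↑ˡ-agree x E) (↑ʳ-agree b (x ++ E))) b≈) φ

        b⊆c-sat : Sat M (bᵥ ⊆ᶠ (wk-b ∘ wk-x ∘ cᵥ)) (b ++ (x ++ E)) ⇔ VAll.All (_∈ toList c) b
        b⊆c-sat = ⊆ᶠ-sat M b≈ (∘-agree c≈ wk-xb≈)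

      ζ-xe-sat : ∀ x → Sat M (rename (xᵥ ⊕ (wk-x ∘ eᵥ)) ζ) (x ++ E) ⇔ Sat M ζ (x ++ e)
      ζ-xe-sat x = rename-sat M (⊕-agree (↑ˡ-agree x E) (∘-agree e≈ (↑ʳ-agree x E))) ζ

    entails-sat : Sat M entails ((e ++ c) ++ y) ⇔ Entails M y φ ζ e (toList c)
    entails-sat =
      Π-cong-⇔ (λ x → →-cong-⇔ (ζ-xe-sat x)
        (Π-cong-⇔ (λ b → →-cong-⇔ (b⊆c-sat x b) (φ-transfers-sat x b)) ⇔-∘ allⁿ-sat M m _ (x ++ E)))
      ⇔-∘ allⁿ-sat M k _ E

    θ-sat : Sat M θ ((e ++ c) ++ y) ⇔ (Sat M ζ (y ++ e) × Entails M y φ ζ e (toList c))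
    θ-sat = rename-sat M (⊕-agree y≈ e≈) ζ ×-⇔ entails-sat

compressionAxiom : ∀ {L k m l} → Formula L (k + m) → Formula L (k + l) → ℕ → Formula (IndLang L k) 0
compressionAxiom {k = k} {l = l} φ ζ n =
  ∀-closure n (exⁿ l (rel (Compression.θ {k = k} φ ζ n) (tabulate var)))

SatisfiesCompression : ∀ {L k} → Structure (IndLang L k) → Set
SatisfiesCompression {L} {k} M =
  (m : ℕ) (φ : Formula L (k + m)) →
  Σ ℕ λ l → Σ (Formula L (k + l)) λ ζ → (n : ℕ) → Sat M (compressionAxiom φ ζ n) []

module _ {C : Set} {A : C → Set} where

  attach : ∀ {n} {c : Vec C n} → VAll.All A c → Vec (Σ C A) n
  attach = VAll.reduce (_ ,_)

  map-proj₁-attach : ∀ {n} {c : Vec C n} (c∈A : VAll.All A c) → map proj₁ (attach c∈A) ≡ c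
  map-proj₁-attach VAll.[]       = refl
  map-proj₁-attach (_ VAll.∷ c∈A) = cong (_ ∷_) (map-proj₁-attach c∈A)

  map-proj₁-All : ∀ {n} (cs : Vec (Σ C A) n) → VAll.All A (map proj₁ cs)
  map-proj₁-All cs = VAllₚ.map⁺ (VAll.universal proj₂ cs)

  module _ {n} {Q : Vec C n → Set} where

    ∀-Σ-Vec⇔ : ((cs : Vec (Σ C A) n) → Q (map proj₁ cs)) ⇔ ((c : Vec C n) → VAll.All A c → Q c)
    ∀-Σ-Vec⇔ = mk⇔ (λ f c c∈A → subst Q (map-proj₁-attach c∈A) (f (attach c∈A)))
                   (λ f cs → f (map proj₁ cs) (map-proj₁-All cs))

    ∃-Σ-Vec⇔ : (∃ λ (cs : Vec (Σ C A) n) → Q (map proj₁ cs)) ⇔ (∃ λ c → VAll.All A c × Q c)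
    ∃-Σ-Vec⇔ = mk⇔ (λ (cs , q) → map proj₁ cs , map-proj₁-All cs , q)
                   (λ (c , c∈A , q) → attach c∈A , subst Q (sym (map-proj₁-attach c∈A)) q)

  ∀-Vec⇔∀-List : {Q : List C → Set} →
                 ((n : ℕ) (c : Vec C n) → VAll.All A c → Q (toList c)) ⇔
                 ((A₀ : List C) → LAll.All A A₀ → Q A₀)
  ∀-Vec⇔∀-List {Q} = mk⇔
    (λ f A₀ A₀∈A → subst Q (toList∘fromList A₀) (f _ (fromList A₀) (VAllₚ.fromList⁺ A₀∈A)))
    (λ f n c c∈A → f (toList c) (VAllₚ.toList⁺ c∈A))

evalTerms-vars : ∀ {L} (M : Structure L) {n} (ρ : Vec (Carrier M) n) → evalTerms M (tabulate var) ρ ≡ ρ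
evalTerms-vars {L} M {n} ρ = begin
  evalTerms M (tabulate var) ρ                 ≡⟨ evalTerms-map (tabulate var) ⟩
  map (λ t → evalTerm M t ρ) (tabulate var)   ≡⟨ tabulate-∘ (λ t → evalTerm M t ρ) var ⟨
  tabulate (lookup ρ)                          ≡⟨ tabulate∘lookup ρ ⟩
  ρ                                            ∎
  where
    open ≡-Reasoning
    evalTerms-map : ∀ {m} (ts : Vec (Term L n) m) → evalTerms M ts ρ ≡ map (λ t → evalTerm M t ρ) ts
    evalTerms-map []       = refl
    evalTerms-map (t ∷ ts) = cong (_ ∷_) (evalTerms-map ts)

module _ {L : Language} (U : Structure L) (A : Carrier U → Set) {k : ℕ} (a : Vec (Carrier U) k) where

  private
    C = Carrier U

  Ind-rel-vars-sat : ∀ {n} (ψ : Formula L (n + k)) (bs : Vec (Σ C A) n) →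
                     Sat (Ind U A a) (rel ψ (tabulate var)) bs ⇔ Sat U ψ (map proj₁ bs ++ a)
  Ind-rel-vars-sat ψ bs = ≡⇒⇔ (cong (λ v → Sat U ψ (map proj₁ v ++ a)) (evalTerms-vars (Ind U A a) bs))

  Compresses : ∀ {m l} → Formula L (k + m) → Formula L (k + l) → List C → Set
  Compresses {l = l} φ ζ A₀ =
    Σ (Vec C l) λ e → VAll.All A e × Sat U ζ (a ++ e) × Entails U a φ ζ e A₀

  compressionAxiom-sat : ∀ {m l} (φ : Formula L (k + m)) (ζ : Formula L (k + l)) n →
    Sat (Ind U A a) (compressionAxiom φ ζ n) [] ⇔
    ((c : Vec C n) → VAll.All A c → Compresses φ ζ (toList c))
  compressionAxiom-sat {l = l} φ ζ n = begin
    Sat M (compressionAxiom φ ζ n) []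
      ≈⟨ ∀-closure-sat M n _ ⟩
    (∀ cs → Sat M (exⁿ l R-θ) cs)
      ≈⟨ Π-cong-⇔ (exⁿ-sat M l R-θ) ⟩
    (∀ cs → ∃ λ es → Sat M R-θ (es ++ cs))
      ≈⟨ Π-cong-⇔ (λ cs → Σ-cong-⇔ (λ es → R-θ-sat es cs)) ⟩
    (∀ (cs : Vec (Σ C A) n) → ∃ λ (es : Vec (Σ C A) l) →
       Sat U ζ (a ++ map proj₁ es) × Entails U a φ ζ (map proj₁ es) (toList (map proj₁ cs)))
      ≈⟨ Π-cong-⇔ (λ cs → ∃-Σ-Vec⇔) ⟩
    (∀ (cs : Vec (Σ C A) n) → Compresses φ ζ (toList (map proj₁ cs)))
      ≈⟨ ∀-Σ-Vec⇔ ⟩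
    (∀ c → VAll.All A c → Compresses φ ζ (toList c))
      ∎
    where
      open SetoidReasoning (⇔-setoid 0ℓ)
      open Compression {k = k} φ ζ n using (θ; θ-sat)
      M = Ind U A a
      R-θ = rel θ (tabulate var)

      R-θ-sat : ∀ es cs → Sat M R-θ (es ++ cs) ⇔
                (Sat U ζ (a ++ map proj₁ es) × Entails U a φ ζ (map proj₁ es) (toList (map proj₁ cs)))
      R-θ-sat es cs =
        θ-sat U (map proj₁ es) (map proj₁ cs) a
          ⇔-∘ (≡⇒⇔ (cong (λ v → Sat U θ (v ++ a)) (map-++ proj₁ es cs))
          ⇔-∘ Ind-rel-vars-sat θ (es ++ cs))

  compressible⇔ : Compressible U A a ⇔ SatisfiesCompression (Ind U A a)
  compressible⇔ = Π-cong-⇔ λ m → Π-cong-⇔ λ φ → Σ-cong-⇔ λ l → Σ-cong-⇔ λ ζ →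
    ⇔-sym (∀-Vec⇔∀-List ⇔-∘ Π-cong-⇔ (compressionAxiom-sat φ ζ))

SatisfiesCompression-cong : ∀ {L k} {M N : Structure (IndLang L k)} →
                            ElemEquiv M N → SatisfiesCompression M ⇔ SatisfiesCompression N
SatisfiesCompression-cong M≡N = Π-cong-⇔ λ m → Π-cong-⇔ λ φ → Σ-cong-⇔ λ l → Σ-cong-⇔ λ ζ →
  Π-cong-⇔ λ n → uncurry mk⇔ (M≡N (compressionAxiom φ ζ n))

lemma3p2 : (L : Language) (U : Structure L) (A A' : Carrier U → Set)
           (k : ℕ) (a a' : Vec (Carrier U) k) →
           ElemEquiv (Ind U A a) (Ind U A' a') →
           Compressible U A a ⇔ Compressible U A' a'
lemma3p2 L U A A' k a a' A≡A' =
  ⇔-sym (compressible⇔ U A' a') ⇔-∘ (SatisfiesCompression-cong A≡A' ⇔-∘ compressible⇔ U A a)
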